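{- For all $\varphi\in\mathcal{L}_{Full}$: $\mathsf{Full}\vdash\varphi\leftrightarrow\varphi^{nf}$.
   Context: Fix countable $\mathsf{P}_0$, $\mathsf{G}_0$. $\mathcal{L}_{NF}$: $\varphi ::= p \mid \neg p \mid \varphi\lor\varphi \mid \varphi\land\varphi \mid \langle\gamma\rangle\varphi$, $\gamma ::= g \mid g^d \mid \gamma;\gamma \mid \gamma\sqcup\gamma \mid \gamma\sqcap\gamma \mid \gamma^* \mid \gamma^\times \mid \varphi? \mid \varphi!$. $\mathcal{L}_{Full}$: $\varphi ::= p \mid \neg\varphi \mid \varphi\lor\varphi \mid \langle\gamma\rangle\varphi$, $\gamma ::= g \mid \gamma;\gamma \mid \gamma\sqcup\gamma \mid \gamma\sqcap\gamma \mid \gamma^* \mid \gamma^\times \mid \gamma^d \mid \varphi? \mid \varphi!$, with $\land,\to,\leftrightarrow$ abbreviations (so $\mathcal{L}_{NF}\subseteq\mathcal{L}_{Full}$). $(\cdot)^{nf}:\mathcal{L}_{Full}\to\mathcal{L}_{NF}$: $p^{nf}=p$, $(\neg p)^{nf}=\neg p$, $(\neg\neg\varphi)^{nf}=\varphi^{nf}$, $(\varphi\lor\psi)^{nf}=\varphi^{nf}\lor\psi^{nf}$, $(\neg(\varphi\lor\psi))^{nf}=(\neg\varphi)^{nf}\land(\neg\psi)^{nf}$, $(\langle\gamma\rangle\varphi)^{nf}=\langle\gamma^{nf}\rangle\varphi^{nf}$, $(\neg\langle\gamma\rangle\varphi)^{nf}=\langle(\gamma^d)^{nf}\rangle(\neg\varphi)^{nf}$;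 $g^{nf}=g$, $;,\sqcup,\sqcap,{}^*,{}^\times$ componentwise, $(\varphi?)^{nf}=\varphi^{nf}?$, $(\varphi!)^{nf}=\varphi^{nf}!$, $(g^d)^{nf}=g^d$, $((\gamma^d)^d)^{nf}=\gamma^{nf}$, $((\gamma\sqcup\delta)^d)^{nf}=(\gamma^d)^{nf}\sqcap(\delta^d)^{nf}$, $((\gamma\sqcap\delta)^d)^{nf}=(\gamma^d)^{nf}\sqcup(\delta^d)^{nf}$, $((\gamma;\delta)^d)^{nf}=(\gamma^d)^{nf};(\delta^d)^{nf}$, $((\gamma^*)^d)^{nf}=((\gamma^d)^{nf})^\times$, $((\gamma^\times)^d)^{nf}=((\gamma^d)^{nf})^*$, $((\varphi?)^d)^{nf}=(\neg\varphi)^{nf}!$, $((\varphi!)^d)^{nf}=(\neg\varphi)^{nf}?$. $\mathsf{Full}$: Hilbert system over $\mathcal{L}_{Full}$ with axioms: propositional tautologies; $\langle\gamma;\delta\rangle\varphi\leftrightarrow\langle\gamma\rangle\langle\delta\rangle\varphi$; $\langle\gamma\sqcup\delta\rangle\varphi\leftrightarrow\langle\gamma\rangle\varphi\lor\langle\delta\rangle\varphi$; $\langle\gamma^*\rangle\varphi\leftrightarrow\varphi\lor\langle\gamma\rangle\langle\gamma^*\rangle\varphi$; $\langle\psi?\rangle\varphi\leftrightarrow\psi\land\varphi$; $\langle\gamma^d\rangle\varphi\leftrightarrow\neg\langle\gamma\rangle\neg\varphi$; $\langle\gamma\sqcap\delta\rangle\varphi\leftrightarrow\langle\gamma\rangle\varphi\land\langle\delta\rangle\varphi$;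 $\langle\gamma^\times\rangle\varphi\leftrightarrow\varphi\land\langle\gamma\rangle\langle\gamma^\times\rangle\varphi$; $\langle\psi!\rangle\varphi\leftrightarrow\psi\lor\varphi$; rules: modus ponens; from $\varphi\to\psi$ infer $\langle\gamma\rangle\varphi\to\langle\gamma\rangle\psi$; from $\langle\gamma\rangle\varphi\to\varphi$ infer $\langle\gamma^*\rangle\varphi\to\varphi$; from $\varphi\to\langle\gamma\rangle\varphi$ infer $\varphi\to\langle\gamma^\times\rangle\varphi$. -}

module Defs where

open import Data.Nat using (ℕ)
open import Data.Bool using (Bool; true; false; not; _∨_)
open import Relation.Binary.PropositionalEquality using (_≡_)

Prop₀ : Set
Prop₀ = ℕ

Game₀ : Set
Game₀ = ℕ

infixr 6 _∨ᶠ_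
infixr 6 _∧ᶠ_
infixr 4 _⇒_
infix 3 _⇔_
infixr 8 ⟨_⟩_
infixr 8 ¬ᶠ_
infixr 7 _⨾_
infixr 6 _⊔_
infixr 6 _⊓_

mutual
  data Form : Set where
    var  : Prop₀ → Form
    ¬ᶠ_  : Form → Form
    _∨ᶠ_ : Form → Form → Form
    ⟨_⟩_ : Game → Form → Form

  data Game : Set where
    atom : Game₀ → Game
    _⨾_  : Game → Game → Game
    _⊔_  : Game → Game → Game
    _⊓_  : Game → Game → Game
    _*   : Game → Game
    _×ᵍ  : Game → Game
    _ᵈ   : Game → Game
    _？   : Form → Game
    _！   : Form → Game

_∧ᶠ_ : Form → Form → Form
φ ∧ᶠ ψ = ¬ᶠ (¬ᶠ φ ∨ᶠ ¬ᶠ ψ)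

_⇒_ : Form → Form → Form
φ ⇒ ψ = ¬ᶠ φ ∨ᶠ ψ

_⇔_ : Form → Form → Form
φ ⇔ ψ = (φ ⇒ ψ) ∧ᶠ (ψ ⇒ φ)

mutual
  data NForm : Set where
    pos  : Prop₀ → NForm
    neg  : Prop₀ → NForm
    _∨ⁿ_ : NForm → NForm → NForm
    _∧ⁿ_ : NForm → NForm → NForm
    ⟨_⟩ⁿ_ : NGame → NForm → NForm

  data NGame : Set where
    atomⁿ  : Game₀ → NGame
    dualⁿ  : Game₀ → NGame
    _⨾ⁿ_   : NGame → NGame → NGame
    _⊔ⁿ_   : NGame → NGame → NGame
    _⊓ⁿ_   : NGame → NGame → NGame
    _*ⁿ    : NGame → NGame
    _×ⁿ    : NGame → NGame
    testⁿ  : NForm → NGame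
    challⁿ : NForm → NGame

-- the inclusion L_NF ⊆ L_Full (∧ read as the Full abbreviation)
mutual
  embF : NForm → Form
  embF (pos p) = var p
  embF (neg p) = ¬ᶠ var p
  embF (φ ∨ⁿ ψ) = embF φ ∨ᶠ embF ψ
  embF (φ ∧ⁿ ψ) = embF φ ∧ᶠ embF ψ
  embF (⟨ γ ⟩ⁿ φ) = ⟨ embG γ ⟩ embF φ

  embG : NGame → Game
  embG (atomⁿ g) = atom g
  embG (dualⁿ g) = atom g ᵈ
  embG (γ ⨾ⁿ δ) = embG γ ⨾ embG δ
  embG (γ ⊔ⁿ δ) = embG γ ⊔ embG δ
  embG (γ ⊓ⁿ δ) = embG γ ⊓ embG δ
  embG (γ *ⁿ) = embG γ *
  embG (γ ×ⁿ) = embG γ ×ᵍ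
  embG (testⁿ φ) = embF φ ？
  embG (challⁿ φ) = embF φ ！

-- the normal-form translation (·)^nf.
-- nfF φ = φ^nf, nfN φ = (¬φ)^nf, nfG γ = γ^nf, nfD γ = (γ^d)^nf.

mutual
  nfF : Form → NForm
  nfF (var p) = pos p
  nfF (¬ᶠ φ) = nfN φ
  nfF (φ ∨ᶠ ψ) = nfF φ ∨ⁿ nfF ψ
  nfF (⟨ γ ⟩ φ) = ⟨ nfG γ ⟩ⁿ nfF φ

  nfN : Form → NForm
  nfN (var p) = neg p
  nfN (¬ᶠ φ) = nfF φ
  nfN (φ ∨ᶠ ψ) = nfN φ ∧ⁿ nfN ψ
  nfN (⟨ γ ⟩ φ) = ⟨ nfD γ ⟩ⁿ nfN φ

  nfG : Game → NGame
  nfG (atom g) = atomⁿ g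
  nfG (γ ⨾ δ) = nfG γ ⨾ⁿ nfG δ
  nfG (γ ⊔ δ) = nfG γ ⊔ⁿ nfG δ
  nfG (γ ⊓ δ) = nfG γ ⊓ⁿ nfG δ
  nfG (γ *) = nfG γ *ⁿ
  nfG (γ ×ᵍ) = nfG γ ×ⁿ
  nfG (γ ᵈ) = nfD γ
  nfG (φ ？) = testⁿ (nfF φ)
  nfG (φ ！) = challⁿ (nfF φ)

  nfD : Game → NGame
  nfD (atom g) = dualⁿ g
  nfD (γ ⨾ δ) = nfD γ ⨾ⁿ nfD δ
  nfD (γ ⊔ δ) = nfD γ ⊓ⁿ nfD δ
  nfD (γ ⊓ δ) = nfD γ ⊔ⁿ nfD δ
  nfD (γ *) = nfD γ ×ⁿ
  nfD (γ ×ᵍ) = nfD γ *ⁿ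
  nfD (γ ᵈ) = nfG γ
  nfD (φ ？) = challⁿ (nfN φ)
  nfD (φ ！) = testⁿ (nfN φ)

nf : Form → Form
nf φ = embF (nfF φ)

⟦_⟧ : Form → (Form → Bool) → Bool
⟦ var p ⟧ v = v (var p)
⟦ ¬ᶠ φ ⟧ v = not (⟦ φ ⟧ v)
⟦ φ ∨ᶠ ψ ⟧ v = ⟦ φ ⟧ v ∨ ⟦ ψ ⟧ v
⟦ ⟨ γ ⟩ φ ⟧ v = v (⟨ γ ⟩ φ)

Tautology : Form → Set
Tautology φ = (v : Form → Bool) → ⟦ φ ⟧ v ≡ true

infix 2 ⊢_

data ⊢_ : Form → Set where
  taut   : ∀ {φ} → Tautology φ → ⊢ φ
  ax-seq : ∀ γ δ φ → ⊢ (⟨ γ ⨾ δ ⟩ φ) ⇔ (⟨ γ ⟩ ⟨ δ ⟩ φ)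
  ax-cho : ∀ γ δ φ → ⊢ (⟨ γ ⊔ δ ⟩ φ) ⇔ (⟨ γ ⟩ φ ∨ᶠ ⟨ δ ⟩ φ)
  ax-it  : ∀ γ φ → ⊢ (⟨ γ * ⟩ φ) ⇔ (φ ∨ᶠ ⟨ γ ⟩ ⟨ γ * ⟩ φ)
  ax-tst : ∀ ψ φ → ⊢ (⟨ ψ ？ ⟩ φ) ⇔ (ψ ∧ᶠ φ)
  ax-dua : ∀ γ φ → ⊢ (⟨ γ ᵈ ⟩ φ) ⇔ (¬ᶠ ⟨ γ ⟩ ¬ᶠ φ)
  ax-dch : ∀ γ δ φ → ⊢ (⟨ γ ⊓ δ ⟩ φ) ⇔ (⟨ γ ⟩ φ ∧ᶠ ⟨ δ ⟩ φ)
  ax-dit : ∀ γ φ → ⊢ (⟨ γ ×ᵍ ⟩ φ) ⇔ (φ ∧ᶠ ⟨ γ ⟩ ⟨ γ ×ᵍ ⟩ φ)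
  ax-chl : ∀ ψ φ → ⊢ (⟨ ψ ！ ⟩ φ) ⇔ (ψ ∨ᶠ φ)
  mp     : ∀ {φ ψ} → ⊢ φ ⇒ ψ → ⊢ φ → ⊢ ψ
  mono   : ∀ {φ ψ} γ → ⊢ φ ⇒ ψ → ⊢ (⟨ γ ⟩ φ) ⇒ (⟨ γ ⟩ ψ)
  ind*   : ∀ {φ} γ → ⊢ (⟨ γ ⟩ φ) ⇒ φ → ⊢ (⟨ γ * ⟩ φ) ⇒ φ
  ind×   : ∀ {φ} γ → ⊢ φ ⇒ (⟨ γ ⟩ φ) → ⊢ φ ⇒ (⟨ γ ×ᵍ ⟩ φ)

-- Proceed by simultaneous induction: φ and ¬φ are provably equivalent to their
-- translations, and γ and γᵈ induce the same modalities as theirs. Every game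
-- constructor respects this equivalence of modalities, and the translation of γᵈ
-- only uses duality laws pushing ᵈ inward. These come from the dual axiom and de
-- Morgan, except for iteration: there the two induction rules exhibit ¬⟨γ*⟩¬ψ and
-- ⟨(γᵈ)×⟩ψ as greatest post-fixpoints of the same map. Purely propositional steps are
-- instances of tautology schemas, certified by evaluating them under all valuations.

module Submission where

open import Data.Bool using (Bool; true; false; not; _∨_; _∧_; T)
open import Data.Bool.Properties using (T-≡; T-∧)
open import Data.Fin using (Fin; zero; suc)
open import Data.Nat using (ℕ; zero; suc)
open import Data.Product using (proj₁; proj₂)
open import Data.Vec using (Vec; []; _∷_; lookup; map)
open import Data.Vec.Properties using (lookup-map)
open import Function using (_∘_)
open import Function.Bundles using (Equivalence)
open import Relation.Binary.PropositionalEquality using (_≡_; sym; trans; cong; cong₂)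

open import Defs

private variable
  n : ℕ
  a b c d ψ θ : Form
  γ δ γ′ δ′ : Game

infixr 8 ‵¬_
infixr 6 _‵∨_ _‵∧_
infixr 4 _‵⇒_
infix 3 _‵⇔_

data Schema (n : ℕ) : Set where
  ‵_   : Fin n → Schema n
  ‵¬_  : Schema n → Schema n
  _‵∨_ : Schema n → Schema n → Schema n

_‵∧_ _‵⇒_ _‵⇔_ : Schema n → Schema n → Schema n
s ‵∧ t = ‵¬ (‵¬ s ‵∨ ‵¬ t)
s ‵⇒ t = ‵¬ s ‵∨ t
s ‵⇔ t = (s ‵⇒ t) ‵∧ (t ‵⇒ s)

P : Schema (suc n)
P = ‵ zero

Q : Schema (suc (suc n))
Q = ‵ suc zero

R : Schema (suc (suc (suc n)))
R = ‵ suc (suc zero)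

S : Schema (suc (suc (suc (suc n))))
S = ‵ suc (suc (suc zero))

infix 9 _⟪_⟫

_⟪_⟫ : Schema n → Vec Form n → Form
(‵ i) ⟪ σ ⟫ = lookup σ i
(‵¬ s) ⟪ σ ⟫ = ¬ᶠ s ⟪ σ ⟫
(s ‵∨ t) ⟪ σ ⟫ = s ⟪ σ ⟫ ∨ᶠ t ⟪ σ ⟫

eval : Schema n → Vec Bool n → Bool
eval (‵ i) ρ = lookup ρ i
eval (‵¬ s) ρ = not (eval s ρ)
eval (s ‵∨ t) ρ = eval s ρ ∨ eval t ρ

⟦⟧-⟪⟫ : (s : Schema n) (σ : Vec Form n) (v : Form → Bool) →
        ⟦ s ⟪ σ ⟫ ⟧ v ≡ eval s (map (λ φ → ⟦ φ ⟧ v) σ)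
⟦⟧-⟪⟫ (‵ i) σ v = sym (lookup-map i (λ φ → ⟦ φ ⟧ v) σ)
⟦⟧-⟪⟫ (‵¬ s) σ v = cong not (⟦⟧-⟪⟫ s σ v)
⟦⟧-⟪⟫ (s ‵∨ t) σ v = cong₂ _∨_ (⟦⟧-⟪⟫ s σ v) (⟦⟧-⟪⟫ t σ v)

all-valuations : (Vec Bool n → Bool) → Bool
all-valuations {zero} f = f []
all-valuations {suc n} f = all-valuations (f ∘ (true ∷_)) ∧ all-valuations (f ∘ (false ∷_))

all-valuations-sound : (f : Vec Bool n → Bool) → T (all-valuations f) → ∀ ρ → T (f ρ)
all-valuations-sound {zero} f t [] = t
all-valuations-sound {suc n} f t (true ∷ ρ) =
  all-valuations-sound (f ∘ (true ∷_)) (proj₁ (Equivalence.to T-∧ t)) ρ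
all-valuations-sound {suc n} f t (false ∷ ρ) =
  all-valuations-sound (f ∘ (false ∷_)) (proj₂ (Equivalence.to T-∧ t)) ρ

-- For a valid schema the implicit certificate has type T true and is found by eta.
tautology : (s : Schema n) {_ : T (all-valuations (eval s))} (σ : Vec Form n) → ⊢ s ⟪ σ ⟫
tautology s {valid} σ = taut λ v →
  trans (⟦⟧-⟪⟫ s σ v) (Equivalence.to T-≡ (all-valuations-sound (eval s) valid _))

mp₂ : ⊢ a ⇒ b ⇒ c → ⊢ a → ⊢ b → ⊢ c
mp₂ ⊢a⇒b⇒c ⊢a ⊢b = mp (mp ⊢a⇒b⇒c ⊢a) ⊢b

⇒-trans : ⊢ a ⇒ b → ⊢ b ⇒ c → ⊢ a ⇒ c
⇒-trans {a} {b} {c} = mp₂ (tautology ((P ‵⇒ Q) ‵⇒ (Q ‵⇒ R) ‵⇒ (P ‵⇒ R)) (a ∷ b ∷ c ∷ []))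

contraposition : ⊢ a ⇒ b → ⊢ ¬ᶠ b ⇒ ¬ᶠ a
contraposition {a} {b} = mp (tautology ((P ‵⇒ Q) ‵⇒ (‵¬ Q ‵⇒ ‵¬ P)) (a ∷ b ∷ []))

contraposition-¬ˡ : ⊢ ¬ᶠ a ⇒ b → ⊢ ¬ᶠ b ⇒ a
contraposition-¬ˡ {a} {b} = mp (tautology ((‵¬ P ‵⇒ Q) ‵⇒ (‵¬ Q ‵⇒ P)) (a ∷ b ∷ []))

contraposition-¬ʳ : ⊢ a ⇒ ¬ᶠ b → ⊢ b ⇒ ¬ᶠ a
contraposition-¬ʳ {a} {b} = mp (tautology ((P ‵⇒ ‵¬ Q) ‵⇒ (Q ‵⇒ ‵¬ P)) (a ∷ b ∷ []))

∨-introˡ : ∀ a b → ⊢ a ⇒ a ∨ᶠ b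
∨-introˡ a b = tautology (P ‵⇒ P ‵∨ Q) (a ∷ b ∷ [])

∨-introʳ : ∀ a b → ⊢ b ⇒ a ∨ᶠ b
∨-introʳ a b = tautology (Q ‵⇒ P ‵∨ Q) (a ∷ b ∷ [])

∧-elimˡ : ∀ a b → ⊢ a ∧ᶠ b ⇒ a
∧-elimˡ a b = tautology (P ‵∧ Q ‵⇒ P) (a ∷ b ∷ [])

∧-elimʳ : ∀ a b → ⊢ a ∧ᶠ b ⇒ b
∧-elimʳ a b = tautology (P ‵∧ Q ‵⇒ Q) (a ∷ b ∷ [])

⇔-intro : ⊢ a ⇒ b → ⊢ b ⇒ a → ⊢ a ⇔ b
⇔-intro {a} {b} = mp₂ (tautology ((P ‵⇒ Q) ‵⇒ (Q ‵⇒ P) ‵⇒ (P ‵⇔ Q)) (a ∷ b ∷ []))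

⇔-to : ⊢ a ⇔ b → ⊢ a ⇒ b
⇔-to {a} {b} = mp (tautology ((P ‵⇔ Q) ‵⇒ (P ‵⇒ Q)) (a ∷ b ∷ []))

⇔-from : ⊢ a ⇔ b → ⊢ b ⇒ a
⇔-from {a} {b} = mp (tautology ((P ‵⇔ Q) ‵⇒ (Q ‵⇒ P)) (a ∷ b ∷ []))

⇔-refl : ∀ a → ⊢ a ⇔ a
⇔-refl a = tautology (P ‵⇔ P) (a ∷ [])

⇔-sym : ⊢ a ⇔ b → ⊢ b ⇔ a
⇔-sym a⇔b = ⇔-intro (⇔-from a⇔b) (⇔-to a⇔b)

infixr 2 _⟫_

_⟫_ : ⊢ a ⇔ b → ⊢ b ⇔ c → ⊢ a ⇔ c
a⇔b ⟫ b⇔c = ⇔-intro (⇒-trans (⇔-to a⇔b) (⇔-to b⇔c)) (⇒-trans (⇔-from b⇔c) (⇔-from a⇔b))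

double-negation : ∀ a → ⊢ ¬ᶠ ¬ᶠ a ⇔ a
double-negation a = tautology (‵¬ ‵¬ P ‵⇔ P) (a ∷ [])

¬-cong : ⊢ a ⇔ b → ⊢ ¬ᶠ a ⇔ ¬ᶠ b
¬-cong a⇔b = ⇔-intro (contraposition (⇔-from a⇔b)) (contraposition (⇔-to a⇔b))

∨-mono : ⊢ a ⇒ b → ⊢ c ⇒ d → ⊢ a ∨ᶠ c ⇒ b ∨ᶠ d
∨-mono {a} {b} {c} {d} =
  mp₂ (tautology ((P ‵⇒ Q) ‵⇒ (R ‵⇒ S) ‵⇒ (P ‵∨ R ‵⇒ Q ‵∨ S)) (a ∷ b ∷ c ∷ d ∷ []))

∨-cong : ⊢ a ⇔ b → ⊢ c ⇔ d → ⊢ a ∨ᶠ c ⇔ b ∨ᶠ d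
∨-cong a⇔b c⇔d = ⇔-intro (∨-mono (⇔-to a⇔b) (⇔-to c⇔d)) (∨-mono (⇔-from a⇔b) (⇔-from c⇔d))

∧-cong : ⊢ a ⇔ b → ⊢ c ⇔ d → ⊢ a ∧ᶠ c ⇔ b ∧ᶠ d
∧-cong a⇔b c⇔d = ¬-cong (∨-cong (¬-cong a⇔b) (¬-cong c⇔d))

¬-∨ : ∀ a b → ⊢ ¬ᶠ (a ∨ᶠ b) ⇔ ¬ᶠ a ∧ᶠ ¬ᶠ b
¬-∨ a b = tautology (‵¬ (P ‵∨ Q) ‵⇔ ‵¬ P ‵∧ ‵¬ Q) (a ∷ b ∷ [])

◇-cong : ∀ γ → ⊢ a ⇔ b → ⊢ ⟨ γ ⟩ a ⇔ ⟨ γ ⟩ b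
◇-cong γ a⇔b = ⇔-intro (mono γ (⇔-to a⇔b)) (mono γ (⇔-from a⇔b))

dual-¬ : ∀ γ a → ⊢ ⟨ γ ᵈ ⟩ ¬ᶠ a ⇔ ¬ᶠ ⟨ γ ⟩ a
dual-¬ γ a = ax-dua γ (¬ᶠ a) ⟫ ¬-cong (◇-cong γ (double-negation a))

¬-dual : ∀ γ a → ⊢ ¬ᶠ ⟨ γ ᵈ ⟩ a ⇔ ⟨ γ ⟩ ¬ᶠ a
¬-dual γ a = ¬-cong (ax-dua γ a) ⟫ double-negation (⟨ γ ⟩ ¬ᶠ a)

*-base : ∀ γ ψ → ⊢ ψ ⇒ ⟨ γ * ⟩ ψ
*-base γ ψ = ⇒-trans (∨-introˡ ψ _) (⇔-from (ax-it γ ψ))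

*-step : ∀ γ ψ → ⊢ ⟨ γ ⟩ ⟨ γ * ⟩ ψ ⇒ ⟨ γ * ⟩ ψ
*-step γ ψ = ⇒-trans (∨-introʳ ψ _) (⇔-from (ax-it γ ψ))

*-least : ∀ γ → ⊢ ψ ⇒ θ → ⊢ ⟨ γ ⟩ θ ⇒ θ → ⊢ ⟨ γ * ⟩ ψ ⇒ θ
*-least γ ψ⇒θ γθ⇒θ = ⇒-trans (mono (γ *) ψ⇒θ) (ind* γ γθ⇒θ)

×-base : ∀ γ ψ → ⊢ ⟨ γ ×ᵍ ⟩ ψ ⇒ ψ
×-base γ ψ = ⇒-trans (⇔-to (ax-dit γ ψ)) (∧-elimˡ ψ _)

×-step : ∀ γ ψ → ⊢ ⟨ γ ×ᵍ ⟩ ψ ⇒ ⟨ γ ⟩ ⟨ γ ×ᵍ ⟩ ψ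
×-step γ ψ = ⇒-trans (⇔-to (ax-dit γ ψ)) (∧-elimʳ ψ _)

×-greatest : ∀ γ → ⊢ θ ⇒ ψ → ⊢ θ ⇒ ⟨ γ ⟩ θ → ⊢ θ ⇒ ⟨ γ ×ᵍ ⟩ ψ
×-greatest γ θ⇒ψ θ⇒γθ = ⇒-trans (ind× γ θ⇒γθ) (mono (γ ×ᵍ) θ⇒ψ)

infix 4 _≈_
infixr 2 _≈⟫_

_≈_ : Game → Game → Set
γ ≈ δ = ∀ ψ → ⊢ ⟨ γ ⟩ ψ ⇔ ⟨ δ ⟩ ψ

≈-refl : γ ≈ γ
≈-refl ψ = ⇔-refl _

≈-sym : γ ≈ δ → δ ≈ γ
≈-sym γ≈δ ψ = ⇔-sym (γ≈δ ψ)

_≈⟫_ : γ ≈ δ → δ ≈ γ′ → γ ≈ γ′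
(γ≈δ ≈⟫ δ≈γ′) ψ = γ≈δ ψ ⟫ δ≈γ′ ψ

⨾-cong : γ ≈ γ′ → δ ≈ δ′ → γ ⨾ δ ≈ γ′ ⨾ δ′
⨾-cong {γ} {γ′} {δ} {δ′} γ≈γ′ δ≈δ′ ψ =
  ax-seq γ δ ψ ⟫ γ≈γ′ _ ⟫ ◇-cong γ′ (δ≈δ′ ψ) ⟫ ⇔-sym (ax-seq γ′ δ′ ψ)

⊔-cong : γ ≈ γ′ → δ ≈ δ′ → γ ⊔ δ ≈ γ′ ⊔ δ′
⊔-cong {γ} {γ′} {δ} {δ′} γ≈γ′ δ≈δ′ ψ =
  ax-cho γ δ ψ ⟫ ∨-cong (γ≈γ′ ψ) (δ≈δ′ ψ) ⟫ ⇔-sym (ax-cho γ′ δ′ ψ)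

⊓-cong : γ ≈ γ′ → δ ≈ δ′ → γ ⊓ δ ≈ γ′ ⊓ δ′
⊓-cong {γ} {γ′} {δ} {δ′} γ≈γ′ δ≈δ′ ψ =
  ax-dch γ δ ψ ⟫ ∧-cong (γ≈γ′ ψ) (δ≈δ′ ψ) ⟫ ⇔-sym (ax-dch γ′ δ′ ψ)

*-mono : (∀ θ → ⊢ ⟨ γ ⟩ θ ⇒ ⟨ δ ⟩ θ) → ∀ ψ → ⊢ ⟨ γ * ⟩ ψ ⇒ ⟨ δ * ⟩ ψ
*-mono {γ} {δ} γ⇒δ ψ = *-least γ (*-base δ ψ) (⇒-trans (γ⇒δ _) (*-step δ ψ))

×-mono : (∀ θ → ⊢ ⟨ γ ⟩ θ ⇒ ⟨ δ ⟩ θ) → ∀ ψ → ⊢ ⟨ γ ×ᵍ ⟩ ψ ⇒ ⟨ δ ×ᵍ ⟩ ψ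
×-mono {γ} {δ} γ⇒δ ψ = ×-greatest δ (×-base γ ψ) (⇒-trans (×-step γ ψ) (γ⇒δ _))

*-cong : γ ≈ δ → γ * ≈ δ *
*-cong γ≈δ ψ = ⇔-intro (*-mono (⇔-to ∘ γ≈δ) ψ) (*-mono (⇔-from ∘ γ≈δ) ψ)

×-cong : γ ≈ δ → γ ×ᵍ ≈ δ ×ᵍ
×-cong γ≈δ ψ = ⇔-intro (×-mono (⇔-to ∘ γ≈δ) ψ) (×-mono (⇔-from ∘ γ≈δ) ψ)

ᵈ-cong : γ ≈ δ → γ ᵈ ≈ δ ᵈ
ᵈ-cong {γ} {δ} γ≈δ ψ = ax-dua γ ψ ⟫ ¬-cong (γ≈δ (¬ᶠ ψ)) ⟫ ⇔-sym (ax-dua δ ψ)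

？-cong : ⊢ a ⇔ b → a ？ ≈ b ？
？-cong {a} {b} a⇔b ψ = ax-tst a ψ ⟫ ∧-cong a⇔b (⇔-refl ψ) ⟫ ⇔-sym (ax-tst b ψ)

！-cong : ⊢ a ⇔ b → a ！ ≈ b ！
！-cong {a} {b} a⇔b ψ = ax-chl a ψ ⟫ ∨-cong a⇔b (⇔-refl ψ) ⟫ ⇔-sym (ax-chl b ψ)

ᵈᵈ : ∀ γ → γ ᵈ ᵈ ≈ γ
ᵈᵈ γ ψ = ax-dua (γ ᵈ) ψ ⟫ ¬-cong (dual-¬ γ ψ) ⟫ double-negation (⟨ γ ⟩ ψ)

-- Since dualisation is an involution, each duality law below yields its mirror image.
dual-swap : γ ≈ δ ᵈ → γ ᵈ ≈ δ
dual-swap {δ = δ} γ≈δᵈ = ᵈ-cong γ≈δᵈ ≈⟫ ᵈᵈ δ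

⨾ᵈ : ∀ γ δ → (γ ⨾ δ) ᵈ ≈ γ ᵈ ⨾ δ ᵈ
⨾ᵈ γ δ ψ =
  ax-dua (γ ⨾ δ) ψ ⟫ ¬-cong (ax-seq γ δ (¬ᶠ ψ)) ⟫ ¬-cong (◇-cong γ (⇔-sym (¬-dual δ ψ)))
  ⟫ ⇔-sym (ax-dua γ (⟨ δ ᵈ ⟩ ψ)) ⟫ ⇔-sym (ax-seq (γ ᵈ) (δ ᵈ) ψ)

⊔ᵈ : ∀ γ δ → (γ ⊔ δ) ᵈ ≈ γ ᵈ ⊓ δ ᵈ
⊔ᵈ γ δ ψ =
  ax-dua (γ ⊔ δ) ψ ⟫ ¬-cong (ax-cho γ δ (¬ᶠ ψ)) ⟫ ¬-∨ (⟨ γ ⟩ ¬ᶠ ψ) (⟨ δ ⟩ ¬ᶠ ψ)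
  ⟫ ∧-cong (⇔-sym (ax-dua γ ψ)) (⇔-sym (ax-dua δ ψ)) ⟫ ⇔-sym (ax-dch (γ ᵈ) (δ ᵈ) ψ)

⊓ᵈ : ∀ γ δ → (γ ⊓ δ) ᵈ ≈ γ ᵈ ⊔ δ ᵈ
⊓ᵈ γ δ = dual-swap (≈-sym (⊔ᵈ (γ ᵈ) (δ ᵈ) ≈⟫ ⊓-cong (ᵈᵈ γ) (ᵈᵈ δ)))

*ᵈ : ∀ γ → γ * ᵈ ≈ γ ᵈ ×ᵍ
*ᵈ γ ψ = ax-dua (γ *) ψ ⟫ ⇔-intro to from
  where
  to : ⊢ ¬ᶠ ⟨ γ * ⟩ ¬ᶠ ψ ⇒ ⟨ γ ᵈ ×ᵍ ⟩ ψ
  to = ×-greatest (γ ᵈ) (contraposition-¬ˡ (*-base γ (¬ᶠ ψ)))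
         (⇒-trans (contraposition (*-step γ (¬ᶠ ψ))) (⇔-from (dual-¬ γ _)))
  from : ⊢ ⟨ γ ᵈ ×ᵍ ⟩ ψ ⇒ ¬ᶠ ⟨ γ * ⟩ ¬ᶠ ψ
  from = contraposition-¬ʳ (*-least γ (contraposition (×-base (γ ᵈ) ψ))
           (⇒-trans (⇔-from (¬-dual γ _)) (contraposition (×-step (γ ᵈ) ψ))))

×ᵈ : ∀ γ → γ ×ᵍ ᵈ ≈ γ ᵈ *
×ᵈ γ = dual-swap (≈-sym (*ᵈ (γ ᵈ) ≈⟫ ×-cong (ᵈᵈ γ)))

？ᵈ : ∀ a → a ？ ᵈ ≈ (¬ᶠ a) ！
？ᵈ a ψ =
  ax-dua (a ？) ψ ⟫ ¬-cong (ax-tst a (¬ᶠ ψ))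
  ⟫ tautology (‵¬ (P ‵∧ ‵¬ Q) ‵⇔ (P ‵⇒ Q)) (a ∷ ψ ∷ []) ⟫ ⇔-sym (ax-chl (¬ᶠ a) ψ)

！ᵈ : ∀ a → a ！ ᵈ ≈ (¬ᶠ a) ？
！ᵈ a = dual-swap (≈-sym (？ᵈ (¬ᶠ a) ≈⟫ ！-cong (double-negation a)))

mutual
  nfF-sound : ∀ φ → ⊢ φ ⇔ embF (nfF φ)
  nfF-sound (var p) = ⇔-refl (var p)
  nfF-sound (¬ᶠ φ) = nfN-sound φ
  nfF-sound (φ ∨ᶠ ψ) = ∨-cong (nfF-sound φ) (nfF-sound ψ)
  nfF-sound (⟨ γ ⟩ φ) = nfG-sound γ φ ⟫ ◇-cong (embG (nfG γ)) (nfF-sound φ)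

  nfN-sound : ∀ φ → ⊢ ¬ᶠ φ ⇔ embF (nfN φ)
  nfN-sound (var p) = ⇔-refl (¬ᶠ var p)
  nfN-sound (¬ᶠ φ) = double-negation φ ⟫ nfF-sound φ
  nfN-sound (φ ∨ᶠ ψ) = ¬-∨ φ ψ ⟫ ∧-cong (nfN-sound φ) (nfN-sound ψ)
  nfN-sound (⟨ γ ⟩ φ) =
    ⇔-sym (dual-¬ γ φ) ⟫ nfD-sound γ (¬ᶠ φ) ⟫ ◇-cong (embG (nfD γ)) (nfN-sound φ)

  nfG-sound : ∀ γ → γ ≈ embG (nfG γ)
  nfG-sound (atom g) = ≈-refl
  nfG-sound (γ ⨾ δ) = ⨾-cong (nfG-sound γ) (nfG-sound δ)
  nfG-sound (γ ⊔ δ) = ⊔-cong (nfG-sound γ) (nfG-sound δ)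
  nfG-sound (γ ⊓ δ) = ⊓-cong (nfG-sound γ) (nfG-sound δ)
  nfG-sound (γ *) = *-cong (nfG-sound γ)
  nfG-sound (γ ×ᵍ) = ×-cong (nfG-sound γ)
  nfG-sound (γ ᵈ) = nfD-sound γ
  nfG-sound (φ ？) = ？-cong (nfF-sound φ)
  nfG-sound (φ ！) = ！-cong (nfF-sound φ)

  nfD-sound : ∀ γ → γ ᵈ ≈ embG (nfD γ)
  nfD-sound (atom g) = ≈-refl
  nfD-sound (γ ⨾ δ) = ⨾ᵈ γ δ ≈⟫ ⨾-cong (nfD-sound γ) (nfD-sound δ)
  nfD-sound (γ ⊔ δ) = ⊔ᵈ γ δ ≈⟫ ⊓-cong (nfD-sound γ) (nfD-sound δ)
  nfD-sound (γ ⊓ δ) = ⊓ᵈ γ δ ≈⟫ ⊔-cong (nfD-sound γ) (nfD-sound δ)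
  nfD-sound (γ *) = *ᵈ γ ≈⟫ ×-cong (nfD-sound γ)
  nfD-sound (γ ×ᵍ) = ×ᵈ γ ≈⟫ *-cong (nfD-sound γ)
  nfD-sound (γ ᵈ) = ᵈᵈ γ ≈⟫ nfG-sound γ
  nfD-sound (φ ？) = ？ᵈ φ ≈⟫ ！-cong (nfN-sound φ)
  nfD-sound (φ ！) = ！ᵈ φ ≈⟫ ？-cong (nfN-sound φ)

lemma17 : (φ : Form) → ⊢ φ ⇔ nf φ
lemma17 = nfF-sound
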